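{- Let $S\subseteq\{1,\dots,n\}$, $I\subseteq\Delta$ and $Z:S\to\mathbb{N}$. Then $(S,I,Z)$ is the rook triple of some rook $r\in R_n$ if and only if the following three conditions hold: (1) $I\subseteq\Delta\cap S^2$, and both $I$ and $(\Delta\cap S^2)\setminus I$ are transitive; (2) $0\le Z(\ell)\le n-|S|$ for every $\ell\in S$; (3) for $b>a$ in $S$, if $(b,a)\in I$ then $Z(b)\ge Z(a)$, and otherwise $Z(b)\le Z(a)$. Moreover, when these conditions hold, the rook $r$ is unique.
   Context: A rook of size $n$ is a word $r=r_1\dots r_n$ over $\{0,\dots,n\}$ whose nonzero letters are pairwise distinct; $R_n$ is the set of these. Let $\Delta=\{(b,a): n\ge b>a>0\}$. A set $I\subseteq\Delta$ is transitive if $(c,b)\in I$ and $(b,a)\in I$ imply $(c,a)\in I$. For a rook $r$: its support $\mathrm{supp}(r)$ is the set of nonzero letters of $r$; its inversion set is $\mathrm{Inv}(r)=\{(r_i,r_j): i<j,\ r_i>r_j>0\}$; for $\ell\in\mathrm{supp}(r)$, $Z_r(\ell)$ is the number of letters $0$ occurring after $\ell$ in $r$. The rook triple of $r$ is $(\mathrm{supp}(r),\mathrm{Inv}(r),Z_r)$. -}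

module Defs where

open import Data.Nat using (ℕ; zero; suc; _+_; _≤_; _<_; _∸_; _≟_; _<?_)
open import Data.Bool using (Bool; true; false; T)
open import Data.Fin using (Fin; toℕ)
open import Data.Vec using (Vec; lookup)
open import Data.List using (List; length; filter; upTo; allFin; map)
open import Data.Product using (Σ; ∃; _×_; _,_)
open import Relation.Nullary using (¬_; Dec; yes; no)
open import Relation.Nullary.Decidable using (_×-dec_)
open import Relation.Binary.PropositionalEquality using (_≡_; _≢_)
open import Function.Bundles using (_⇔_)

IsRook : (n : ℕ) → Vec ℕ n → Set
IsRook n r =
  (∀ (i : Fin n) → lookup r i ≤ n) ×
  (∀ (i j : Fin n) → i ≢ j → lookup r i ≡ lookup r j → lookup r i ≡ 0)

InΔ : ℕ → ℕ → ℕ → Set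
InΔ n b a = (b ≤ n) × (a < b) × (0 < a)

TransitiveRel : (ℕ → ℕ → Set) → Set
TransitiveRel R = ∀ c b a → R c b → R b a → R c a

InSupp : ∀ {n} → Vec ℕ n → ℕ → Set
InSupp {n} r ℓ = (0 < ℓ) × (∃ λ (i : Fin n) → lookup r i ≡ ℓ)

InInv : ∀ {n} → Vec ℕ n → ℕ → ℕ → Set
InInv {n} r b a =
  Σ (Fin n) λ i → Σ (Fin n) λ j →
    (toℕ i < toℕ j) × (lookup r i ≡ b) × (lookup r j ≡ a) × (a < b) × (0 < a)

zerosAfter : ∀ {n} → Vec ℕ n → Fin n → ℕ
zerosAfter {n} r i =
  length (filter (λ j → (toℕ i <? toℕ j) ×-dec (lookup r j ≟ 0)) (allFin n))

ZrIs : ∀ {n} → Vec ℕ n → ℕ → ℕ → Set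
ZrIs {n} r ℓ z = ∀ (i : Fin n) → lookup r i ≡ ℓ → zerosAfter r i ≡ z

card : ℕ → (ℕ → Bool) → ℕ
card n S = length (filter (λ ℓ → T? (S (suc ℓ))) (upTo n))
  where
  T? : (b : Bool) → Dec (T b)
  T? true = yes _
  T? false = no (λ ())

IsRookTriple : ∀ {n} → Vec ℕ n → (ℕ → Bool) → (ℕ → ℕ → Bool) → (ℕ → ℕ) → Set
IsRookTriple r S I Z =
  (∀ ℓ → (T (S ℓ) ⇔ InSupp r ℓ)) ×
  (∀ b a → (T (I b a) ⇔ InInv r b a)) ×
  (∀ ℓ → T (S ℓ) → ZrIs r ℓ (Z ℓ))

Cond1 : ℕ → (ℕ → Bool) → (ℕ → ℕ → Bool) → Set
Cond1 n S I =
  (∀ b a → T (I b a) → InΔ n b a × T (S b) × T (S a)) ×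
  TransitiveRel (λ b a → T (I b a)) ×
  TransitiveRel (λ b a → InΔ n b a × T (S b) × T (S a) × ¬ T (I b a))

Cond2 : ℕ → (ℕ → Bool) → (ℕ → ℕ) → Set
Cond2 n S Z = ∀ ℓ → T (S ℓ) → Z ℓ ≤ n ∸ card n S

Cond3 : (ℕ → Bool) → (ℕ → ℕ → Bool) → (ℕ → ℕ) → Set
Cond3 S I Z =
  ∀ b a → T (S b) → T (S a) → a < b →
    (T (I b a) → Z a ≤ Z b) × (¬ T (I b a) → Z b ≤ Z a)

-- Write m ≺ ℓ when m stands left of ℓ in a rook with inversion set I: for b > a, b ≺ a iff
-- (b , a) ∈ I.  A rook lists its letters in ≺-order, so ≺ must be a strict total order on S,
-- which is exactly condition (1).  A letter ℓ preceded by the p = before ℓ letters of S has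
-- n − |S| − Z ℓ zeros to its left, so it stands at position p + n − |S| − Z ℓ.  Hence all
-- positions are forced.  Conversely, write each ℓ ∈ S at that position and 0 elsewhere:
-- condition (3) makes the position strictly increasing along ≺, so this is a rook with
-- inversion set I, and (2) makes the subtraction honest, so ℓ has Z ℓ zeros after it.

module Submission where

open import Defs
open import Data.Nat using (ℕ; zero; suc; _+_; _∸_; _≤_; _<_; z≤n; s≤s; z<s; s≤s⁻¹)
open import Data.Nat.Properties
open import Data.Bool using (Bool; T; T?)
open import Data.Fin using (Fin; toℕ; fromℕ<) renaming (zero to fzero; suc to fsuc)
open import Data.Fin.Properties using (toℕ-injective; toℕ-fromℕ<; toℕ<n) renaming (_≟_ to _≟ᶠ_)
open import Data.Vec using (Vec; lookup; tabulate)
open import Data.Vec.Properties using (lookup∘tabulate; tabulate∘lookup; tabulate-cong)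
open import Data.List as List using (List; []; _∷_; length; filter; map; upTo; allFin)
open import Data.List.Properties using (filter-≐; filter-accept; filter-reject; filter-none; filter-some; length-filter; length-upTo; length-tabulate)
open import Data.List.Membership.Propositional using (_∈_; lose)
open import Data.List.Membership.Propositional.Properties using (∈-allFin; ∈-upTo⁺; ∈-map⁺)
open import Data.List.Relation.Unary.Any using (here; there; any?; satisfied)
import Data.List.Relation.Unary.All as All
open import Data.List.Relation.Unary.Unique.Propositional using (Unique; _∷_)
open import Data.List.Relation.Unary.Unique.Propositional.Properties using (allFin⁺; upTo⁺; map⁺)
open import Data.List.Relation.Binary.Sublist.Propositional using (⊆-refl)
open import Data.List.Relation.Binary.Sublist.Propositional.Properties using (filter⁺; length-mono-≤)
open import Data.Product using (Σ; ∃; _×_; _,_; proj₁; proj₂; swap)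
open import Data.Sum using (_⊎_; inj₁; inj₂)
open import Function using (_∘_; case_of_)
open import Function.Bundles using (_⇔_; mk⇔; Equivalence)
open import Level using (0ℓ)
open import Relation.Binary using (DecidableEquality; tri<; tri≈; tri>)
open import Relation.Binary.PropositionalEquality
open import Relation.Nullary using (¬_; ¬?; Dec; yes; no; contradiction; _×-dec_; _⊎-dec_)
open import Relation.Nullary.Decidable using (decidable-stable)
open import Relation.Unary using (Pred; Decidable; _⊆_; _≐_)
open import Relation.Unary.Properties using (_∩?_; ∁?)

open Equivalence using (to; from)

-- Counting with decidable predicates

count : {A : Set} {P : Pred A 0ℓ} → Decidable P → List A → ℕ
count P? xs = length (filter P? xs)

module _ {A : Set} {P Q : Pred A 0ℓ} (P? : Decidable P) (Q? : Decidable Q) where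

  count-≐ : P ≐ Q → ∀ xs → count P? xs ≡ count Q? xs
  count-≐ P≐Q xs = cong length (filter-≐ P? Q? P≐Q xs)

  count-split : ∀ xs → count P? xs ≡ count (P? ∩? Q?) xs + count (P? ∩? ∁? Q?) xs
  count-split [] = refl
  count-split (x ∷ xs) with P? x | Q? x
  ... | yes _ | yes _ = cong suc (count-split xs)
  ... | yes _ | no _  = trans (cong suc (count-split xs)) (sym (+-suc _ _))
  ... | no _  | _     = count-split xs

module _ {A : Set} {P Q : Pred A 0ℓ} (P? : Decidable P) (Q? : Decidable Q) where

  count-mono : P ⊆ Q → ∀ xs → count P? xs ≤ count Q? xs
  count-mono P⊆Q xs = length-mono-≤ (filter⁺ P? Q? (λ { refl → P⊆Q }) (⊆-refl {x = xs}))

  count-mono-< : P ⊆ Q → ∀ {x xs} → x ∈ xs → Q x → ¬ P x → count P? xs < count Q? xs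
  count-mono-< P⊆Q {x} {xs} x∈xs Qx ¬Px = begin-strict
    count P? xs                                    ≡⟨ count-≐ P? (Q? ∩? P?) ((λ Px → P⊆Q Px , Px) , proj₂) xs ⟩
    count (Q? ∩? P?) xs                            <⟨ m<m+n _ (filter-some (Q? ∩? ∁? P?) (lose x∈xs (Qx , ¬Px))) ⟩
    count (Q? ∩? P?) xs + count (Q? ∩? ∁? P?) xs  ≡⟨ count-split Q? P? xs ⟨
    count Q? xs                                    ∎
    where open ≤-Reasoning

module _ {A : Set} {P : Pred A 0ℓ} (P? : Decidable P) where

  count-complement : ∀ xs → count P? xs + count (∁? P?) xs ≡ length xs
  count-complement [] = refl
  count-complement (x ∷ xs) with P? x
  ... | yes _ = cong suc (count-complement xs)
  ... | no _  = trans (+-suc _ _) (cong suc (count-complement xs))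

  count-map : {B : Set} (f : B → A) → ∀ xs → count P? (map f xs) ≡ count (λ x → P? (f x)) xs
  count-map f [] = refl
  count-map f (x ∷ xs) with P? (f x)
  ... | yes _ = cong suc (count-map f xs)
  ... | no _  = count-map f xs

count-tabulate-< : {A : Set} {P : Pred A 0ℓ} (P? : Decidable P) {m t : ℕ} (f : Fin m → A) →
  t ≤ m → (∀ k → P (f k) → toℕ k < t) → (∀ k → toℕ k < t → P (f k)) →
  count P? (List.tabulate f) ≡ t
count-tabulate-< P? {zero} f z≤n _ _ = refl
count-tabulate-< P? {suc m} {zero} f _ sound _
  rewrite filter-reject P? {xs = List.tabulate (λ k → f (fsuc k))} (λ p → contradiction (sound fzero p) λ ())
  = count-tabulate-< P? (λ k → f (fsuc k)) z≤n (λ k p → contradiction (sound (fsuc k) p) λ ()) λ _ ()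
count-tabulate-< P? {suc m} {suc t} f (s≤s t≤m) sound complete
  rewrite filter-accept P? {xs = List.tabulate (λ k → f (fsuc k))} (complete fzero z<s)
  = cong suc (count-tabulate-< P? (λ k → f (fsuc k)) t≤m (λ k p → s≤s⁻¹ (sound (fsuc k) p)) λ k k<t → complete (fsuc k) (s≤s k<t))

module _ {B : Set} (_≟ᴮ_ : DecidableEquality B) where

  _≢?_ : (y : B) → Decidable (_≢ y)
  (y ≢? z) = ¬? (z ≟ᴮ y)

  count-remove : {Q : Pred B 0ℓ} (Q? : Decidable Q) → ∀ {y ys} → Unique ys → y ∈ ys → Q y →
    count Q? ys ≡ suc (count (Q? ∩? (y ≢?_)) ys)
  count-remove Q? {y} {_ ∷ ys} (y∉ys ∷ _) (here refl) Qy = begin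
    count Q? (y ∷ ys)                                          ≡⟨ cong length (filter-accept Q? Qy) ⟩
    suc (count Q? ys)                                          ≡⟨ cong suc (count-split Q? (y ≢?_) ys) ⟩
    suc (count (Q? ∩? (y ≢?_)) ys + count (Q? ∩? ∁? (y ≢?_)) ys) ≡⟨ cong (λ k → suc (count (Q? ∩? (y ≢?_)) ys + k)) none ⟩
    suc (count (Q? ∩? (y ≢?_)) ys + 0)                        ≡⟨ cong suc (+-identityʳ _) ⟩
    suc (count (Q? ∩? (y ≢?_)) ys)                            ≡⟨ cong (suc ∘ length) (filter-reject (Q? ∩? (y ≢?_)) (λ (_ , y≢y) → y≢y refl)) ⟨
    suc (count (Q? ∩? (y ≢?_)) (y ∷ ys))                      ∎
    where
    open ≡-Reasoning
    none : count (Q? ∩? ∁? (y ≢?_)) ys ≡ 0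
    none = cong length (filter-none (Q? ∩? ∁? (y ≢?_)) (All.map (λ y≢z (_ , ¬z≢y) → ¬z≢y (y≢z ∘ sym)) y∉ys))
  count-remove {Q} Q? {y} {z ∷ ys} (z∉ys ∷ u) (there y∈ys) Qy = by-cases (Q? z)
    where
    z≢y : z ≢ y
    z≢y = All.lookup z∉ys y∈ys
    by-cases : Dec (Q z) → count Q? (z ∷ ys) ≡ suc (count (Q? ∩? (y ≢?_)) (z ∷ ys))
    by-cases (yes Qz) = begin
      count Q? (z ∷ ys)                          ≡⟨ cong length (filter-accept Q? Qz) ⟩
      suc (count Q? ys)                          ≡⟨ cong suc (count-remove Q? u y∈ys Qy) ⟩
      suc (suc (count (Q? ∩? (y ≢?_)) ys))       ≡⟨ cong (suc ∘ length) (filter-accept (Q? ∩? (y ≢?_)) (Qz , z≢y)) ⟨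
      suc (count (Q? ∩? (y ≢?_)) (z ∷ ys))       ∎
      where open ≡-Reasoning
    by-cases (no ¬Qz) = begin
      count Q? (z ∷ ys)                          ≡⟨ cong length (filter-reject Q? ¬Qz) ⟩
      count Q? ys                                ≡⟨ count-remove Q? u y∈ys Qy ⟩
      suc (count (Q? ∩? (y ≢?_)) ys)             ≡⟨ cong (suc ∘ length) (filter-reject (Q? ∩? (y ≢?_)) (¬Qz ∘ proj₁)) ⟨
      suc (count (Q? ∩? (y ≢?_)) (z ∷ ys))       ∎
      where open ≡-Reasoning

  count-bijection : {A : Set} {P : Pred A 0ℓ} {Q : Pred B 0ℓ} (P? : Decidable P) (Q? : Decidable Q) (f : A → B) →
    ∀ {xs ys} → Unique xs → Unique ys →
    (∀ {x} → x ∈ xs → P x → f x ∈ ys × Q (f x)) →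
    (∀ {x x′} → P x → P x′ → f x ≡ f x′ → x ≡ x′) →
    (∀ {y} → y ∈ ys → Q y → ∃ λ x → x ∈ xs × P x × f x ≡ y) →
    count P? xs ≡ count Q? ys
  count-bijection P? Q? f {[]} _ _ _ _ onto =
    sym (cong length (filter-none Q? (All.tabulate λ y∈ys Qy → case onto y∈ys Qy of λ { (_ , () , _) })))
  count-bijection {P = P} {Q} P? Q? f {x ∷ xs} {ys} (x∉xs ∷ uxs) uys into inj onto = by-cases (P? x)
    where
    by-cases : Dec (P x) → count P? (x ∷ xs) ≡ count Q? ys
    by-cases (no ¬Px) = trans (cong length (filter-reject P? ¬Px))
      (count-bijection P? Q? f uxs uys (into ∘ there) inj onto′)
      where
      onto′ : ∀ {y} → y ∈ ys → Q y → ∃ λ x′ → x′ ∈ xs × P x′ × f x′ ≡ y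
      onto′ y∈ys Qy with onto y∈ys Qy
      ... | _ , here refl , Px , _ = contradiction Px ¬Px
      ... | x′ , there x′∈xs , Px′ , fx′≡y = x′ , x′∈xs , Px′ , fx′≡y
    by-cases (yes Px) = begin
      count P? (x ∷ xs)                 ≡⟨ cong length (filter-accept P? Px) ⟩
      suc (count P? xs)                 ≡⟨ cong suc (count-bijection P? (Q? ∩? (f x ≢?_)) f uxs uys into′ inj onto′) ⟩
      suc (count (Q? ∩? (f x ≢?_)) ys)  ≡⟨ count-remove Q? uys fx∈ys Qfx ⟨
      count Q? ys                       ∎
      where
      open ≡-Reasoning
      fx∈ys : f x ∈ ys
      fx∈ys = proj₁ (into (here refl) Px)
      Qfx : Q (f x)
      Qfx = proj₂ (into (here refl) Px)
      into′ : ∀ {x′} → x′ ∈ xs → P x′ → f x′ ∈ ys × (Q (f x′) × f x′ ≢ f x)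
      into′ x′∈xs Px′ = let (fx′∈ys , Qfx′) = into (there x′∈xs) Px′ in
        fx′∈ys , Qfx′ , λ fx′≡fx → All.lookup x∉xs x′∈xs (sym (inj Px′ Px fx′≡fx))
      onto′ : ∀ {y} → y ∈ ys → Q y × y ≢ f x → ∃ λ x′ → x′ ∈ xs × P x′ × f x′ ≡ y
      onto′ y∈ys (Qy , y≢fx) with onto y∈ys Qy
      ... | _ , here refl , _ , fx≡y = contradiction (sym fx≡y) y≢fx
      ... | x′ , there x′∈xs , Px′ , fx′≡y = x′ , x′∈xs , Px′ , fx′≡y

-- Rook triples

module RookTriples (n : ℕ) (S : ℕ → Bool) (I : ℕ → ℕ → Bool) where

  S? : Decidable (λ ℓ → T (S ℓ))
  S? ℓ = T? (S ℓ)

  letters : List ℕ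
  letters = map suc (upTo n)

  letters-unique : Unique letters
  letters-unique = map⁺ suc-injective (upTo⁺ n)

  ∈-letters : ∀ {ℓ} → 0 < ℓ → ℓ ≤ n → ℓ ∈ letters
  ∈-letters {suc ℓ} _ ℓ<n = ∈-map⁺ suc (∈-upTo⁺ ℓ<n)

  card≡count : card n S ≡ count S? letters
  card≡count = trans (count-≐ _ (S? ∘ suc) ((λ s → s) , (λ s → s)) (upTo n)) (sym (count-map S? suc (upTo n)))

  card≤n : card n S ≤ n
  card≤n = ≤-trans (length-filter _ (upTo n)) (≤-reflexive (length-upTo n))

  zeros : ℕ
  zeros = n ∸ card n S

  -- m ≺ ℓ: the letter m stands to the left of ℓ in every rook with inversion set I.
  _≺_ : ℕ → ℕ → Set
  m ≺ ℓ = (ℓ < m × T (I m ℓ)) ⊎ (m < ℓ × ¬ T (I ℓ m))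

  _≺?_ : (m ℓ : ℕ) → Dec (m ≺ ℓ)
  m ≺? ℓ = ((ℓ <? m) ×-dec T? (I m ℓ)) ⊎-dec ((m <? ℓ) ×-dec ¬? (T? (I ℓ m)))

  ≺-irrefl : ∀ {ℓ} → ¬ ℓ ≺ ℓ
  ≺-irrefl (inj₁ (ℓ<ℓ , _)) = <-irrefl refl ℓ<ℓ
  ≺-irrefl (inj₂ (ℓ<ℓ , _)) = <-irrefl refl ℓ<ℓ

  ≺-connex : ∀ {m ℓ} → m ≢ ℓ → m ≺ ℓ ⊎ ℓ ≺ m
  ≺-connex {m} {ℓ} m≢ℓ with <-cmp m ℓ
  ... | tri≈ _ m≡ℓ _ = contradiction m≡ℓ m≢ℓ
  ... | tri< m<ℓ _ _ with T? (I ℓ m)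
  ...   | yes Iℓm = inj₂ (inj₁ (m<ℓ , Iℓm))
  ...   | no ¬Iℓm = inj₁ (inj₂ (m<ℓ , ¬Iℓm))
  ≺-connex {m} {ℓ} m≢ℓ | tri> _ _ ℓ<m with T? (I m ℓ)
  ...   | yes Imℓ = inj₁ (inj₁ (ℓ<m , Imℓ))
  ...   | no ¬Imℓ = inj₂ (inj₂ (ℓ<m , ¬Imℓ))

  ≺⇒I : ∀ {a b} → a < b → b ≺ a → T (I b a)
  ≺⇒I _   (inj₁ (_ , Iba)) = Iba
  ≺⇒I a<b (inj₂ (b<a , _)) = contradiction b<a (<⇒≯ a<b)

  ≺⇒¬I : ∀ {a b} → a < b → a ≺ b → ¬ T (I b a)
  ≺⇒¬I a<b (inj₁ (b<a , _))  = contradiction b<a (<⇒≯ a<b)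
  ≺⇒¬I _   (inj₂ (_ , ¬Iba)) = ¬Iba

  before : ℕ → ℕ
  before ℓ = count (λ m → S? m ×-dec (m ≺? ℓ)) letters

  ≺-Transitive : Set
  ≺-Transitive = ∀ {a b c} → T (S a) → T (S b) → T (S c) → a ≺ b → b ≺ c → a ≺ c

  Antitone : (ℕ → ℕ) → Set
  Antitone Z = ∀ {m ℓ} → T (S m) → T (S ℓ) → m ≺ ℓ → Z ℓ ≤ Z m

  ≺-transitive⇒Cond1 : (∀ b a → T (I b a) → InΔ n b a × T (S b) × T (S a)) → ≺-Transitive → Cond1 n S I
  ≺-transitive⇒Cond1 I⊆ ≺-trans = I⊆ , I-trans , noninversion-trans
    where
    I-trans : TransitiveRel (λ b a → T (I b a))
    I-trans c b a Icb Iba =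
      let ((_ , b<c , _) , sc , sb) = I⊆ c b Icb
          ((_ , a<b , _) , _ , sa)  = I⊆ b a Iba
      in ≺⇒I (<-trans a<b b<c) (≺-trans sc sb sa (inj₁ (b<c , Icb)) (inj₁ (a<b , Iba)))
    noninversion-trans : TransitiveRel (λ b a → InΔ n b a × T (S b) × T (S a) × ¬ T (I b a))
    noninversion-trans c b a ((c≤n , b<c , _) , sc , sb , ¬Icb) ((_ , a<b , 0<a) , _ , sa , ¬Iba) =
      (c≤n , a<c , 0<a) , sc , sa , ≺⇒¬I a<c (≺-trans sa sb sc (inj₂ (a<b , ¬Iba)) (inj₂ (b<c , ¬Icb)))
      where
      a<c : a < c
      a<c = <-trans a<b b<c

  Cond1⇒≺-transitive : (∀ ℓ → T (S ℓ) → (1 ≤ ℓ) × (ℓ ≤ n)) → Cond1 n S I → ≺-Transitive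
  Cond1⇒≺-transitive hS (_ , I-trans , noninversion-trans) {a} {b} {c} sa sb sc = go
    where
    ¬I-trans : ∀ {x y z} → T (S x) → T (S y) → T (S z) → y < x → z < y →
      ¬ T (I x y) → ¬ T (I y z) → ¬ T (I x z)
    ¬I-trans {x} {y} {z} sx sy sz y<x z<y ¬Ixy ¬Iyz =
      proj₂ (proj₂ (proj₂ (noninversion-trans x y z
        ((proj₂ (hS x sx) , y<x , proj₁ (hS y sy)) , sx , sy , ¬Ixy)
        ((proj₂ (hS y sy) , z<y , proj₁ (hS z sz)) , sy , sz , ¬Iyz))))
    go : a ≺ b → b ≺ c → a ≺ c
    go (inj₁ (b<a , Iab)) (inj₁ (c<b , Ibc)) = inj₁ (<-trans c<b b<a , I-trans a b c Iab Ibc)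
    go (inj₂ (a<b , ¬Iba)) (inj₂ (b<c , ¬Icb)) = inj₂ (<-trans a<b b<c , ¬I-trans sc sb sa b<c a<b ¬Icb ¬Iba)
    go (inj₁ (b<a , Iab)) (inj₂ (b<c , ¬Icb)) with <-cmp a c
    ... | tri< a<c _ _ = inj₂ (a<c , λ Ica → ¬Icb (I-trans c a b Ica Iab))
    ... | tri≈ _ refl _ = contradiction Iab ¬Icb
    ... | tri> _ _ c<a = inj₁ (c<a , decidable-stable (T? (I a c)) λ ¬Iac → ¬I-trans sa sc sb c<a b<c ¬Iac ¬Icb Iab)
    go (inj₂ (a<b , ¬Iba)) (inj₁ (c<b , Ibc)) with <-cmp a c
    ... | tri< a<c _ _ = inj₂ (a<c , λ Ica → ¬Iba (I-trans b c a Ibc Ica))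
    ... | tri≈ _ refl _ = contradiction Ibc ¬Iba
    ... | tri> _ _ c<a = inj₁ (c<a , decidable-stable (T? (I a c)) λ ¬Iac → ¬I-trans sb sa sc a<b c<a ¬Iba ¬Iac Ibc)

  antitone⇒Cond3 : ∀ {Z} → Antitone Z → Cond3 S I Z
  antitone⇒Cond3 anti b a sb sa a<b = (λ Iba → anti sb sa (inj₁ (a<b , Iba))) , (λ ¬Iba → anti sa sb (inj₂ (a<b , ¬Iba)))

  Cond3⇒antitone : ∀ {Z} → Cond3 S I Z → Antitone Z
  Cond3⇒antitone C3 sm sℓ (inj₁ (ℓ<m , Imℓ))  = proj₁ (C3 _ _ sm sℓ ℓ<m) Imℓ
  Cond3⇒antitone C3 sm sℓ (inj₂ (m<ℓ , ¬Iℓm)) = proj₂ (C3 _ _ sℓ sm m<ℓ) ¬Iℓm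

  module RookFacts {r : Vec ℕ n} (rook : IsRook n r)
                   (supp : ∀ ℓ → T (S ℓ) ⇔ InSupp r ℓ)
                   (inv : ∀ b a → T (I b a) ⇔ InInv r b a) where

    lookup-injective : ∀ {i j} → lookup r i ≡ lookup r j → lookup r i ≢ 0 → i ≡ j
    lookup-injective {i} {j} ri≡rj ri≢0 with i ≟ᶠ j
    ... | yes i≡j = i≡j
    ... | no i≢j = contradiction (proj₂ rook i j i≢j ri≡rj) ri≢0

    lookup≢0 : ∀ {k b} → lookup r k ≡ b → 0 < b → lookup r k ≢ 0
    lookup≢0 rk≡b 0<b rk≡0 = <⇒≢ 0<b (trans (sym rk≡0) rk≡b)

    S-positive : ∀ {ℓ} → T (S ℓ) → 0 < ℓ
    S-positive s = proj₁ (to (supp _) s)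

    index : ∀ {ℓ} → T (S ℓ) → Fin n
    index s = proj₁ (proj₂ (to (supp _) s))

    lookup-index : ∀ {ℓ} (s : T (S ℓ)) → lookup r (index s) ≡ ℓ
    lookup-index s = proj₂ (proj₂ (to (supp _) s))

    lookup-S : ∀ {k} → lookup r k ≢ 0 → T (S (lookup r k))
    lookup-S {k} rk≢0 = from (supp _) (n≢0⇒n>0 rk≢0 , k , refl)

    lookup-∈-letters : ∀ {k} → lookup r k ≢ 0 → lookup r k ∈ letters
    lookup-∈-letters {k} rk≢0 = ∈-letters (n≢0⇒n>0 rk≢0) (proj₁ rook k)

    inversion⇒< : ∀ {k i b a} → lookup r k ≡ b → lookup r i ≡ a → 0 < a → T (I b a) → toℕ k < toℕ i
    inversion⇒< rk≡b ri≡a 0<a Iba with to (inv _ _) Iba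
    ... | k′ , i′ , k′<i′ , rk′≡b , ri′≡a , a<b , _ =
      subst₂ _<_ (cong toℕ (lookup-injective (trans rk′≡b (sym rk≡b)) (lookup≢0 rk′≡b (<-trans 0<a a<b))))
                 (cong toℕ (lookup-injective (trans ri′≡a (sym ri≡a)) (lookup≢0 ri′≡a 0<a)))
                 k′<i′

    ≺⇔< : ∀ {k i m ℓ} → lookup r k ≡ m → lookup r i ≡ ℓ → 0 < m → 0 < ℓ → m ≺ ℓ ⇔ toℕ k < toℕ i
    ≺⇔< {k} {i} {m} {ℓ} rk≡m ri≡ℓ 0<m 0<ℓ = mk⇔ ≺⇒< <⇒≺
      where
      ≺⇒< : m ≺ ℓ → toℕ k < toℕ i
      ≺⇒< (inj₁ (_ , Imℓ)) = inversion⇒< rk≡m ri≡ℓ 0<ℓ Imℓ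
      ≺⇒< (inj₂ (m<ℓ , ¬Iℓm)) with <-cmp (toℕ k) (toℕ i)
      ... | tri< k<i _ _ = k<i
      ... | tri≈ _ k≡i _ = contradiction (trans (sym rk≡m) (trans (cong (lookup r) (toℕ-injective k≡i)) ri≡ℓ)) (<⇒≢ m<ℓ)
      ... | tri> _ _ i<k = contradiction (from (inv _ _) (i , k , i<k , ri≡ℓ , rk≡m , m<ℓ , 0<m)) ¬Iℓm
      <⇒≺ : toℕ k < toℕ i → m ≺ ℓ
      <⇒≺ k<i with <-cmp m ℓ
      ... | tri< m<ℓ _ _ = inj₂ (m<ℓ , λ Iℓm → <-asym k<i (inversion⇒< ri≡ℓ rk≡m 0<m Iℓm))
      ... | tri≈ _ m≡ℓ _ =
        contradiction (cong toℕ (lookup-injective (trans rk≡m (trans m≡ℓ (sym ri≡ℓ))) (lookup≢0 rk≡m 0<m)))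
                      (<⇒≢ k<i)
      ... | tri> _ _ ℓ<m = inj₁ (ℓ<m , from (inv _ _) (k , i , k<i , rk≡m , ri≡ℓ , ℓ<m , 0<ℓ))

    index-≺⇔< : ∀ {m ℓ} (sm : T (S m)) (sℓ : T (S ℓ)) → m ≺ ℓ ⇔ toℕ (index sm) < toℕ (index sℓ)
    index-≺⇔< sm sℓ = ≺⇔< (lookup-index sm) (lookup-index sℓ) (S-positive sm) (S-positive sℓ)

    ≺-transitive : ≺-Transitive
    ≺-transitive sa sb sc a≺b b≺c =
      from (index-≺⇔< sa sc) (<-trans (to (index-≺⇔< sa sb) a≺b) (to (index-≺⇔< sb sc) b≺c))

    I⊆Δ×S×S : ∀ b a → T (I b a) → InΔ n b a × T (S b) × T (S a)
    I⊆Δ×S×S b a Iba with to (inv b a) Iba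
    ... | k , i , _ , rk≡b , ri≡a , a<b , 0<a =
      (subst (_≤ n) rk≡b (proj₁ rook k) , a<b , 0<a) ,
      from (supp b) (<-trans 0<a a<b , k , rk≡b) , from (supp a) (0<a , i , ri≡a)

    zero? : Decidable (λ k → lookup r k ≡ 0)
    zero? k = lookup r k ≟ 0

    left? : (i : Fin n) → Decidable (λ (k : Fin n) → toℕ k < toℕ i)
    left? i k = toℕ k <? toℕ i

    right? : (i : Fin n) → Decidable (λ (k : Fin n) → toℕ i < toℕ k)
    right? i k = toℕ i <? toℕ k

    nonzero-count : count (∁? zero?) (allFin n) ≡ card n S
    nonzero-count = trans
      (count-bijection _≟_ (∁? zero?) S? (lookup r) (allFin⁺ n) letters-unique
        (λ _ rk≢0 → lookup-∈-letters rk≢0 , lookup-S rk≢0)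
        (λ rk≢0 _ rk≡rk′ → lookup-injective rk≡rk′ rk≢0)
        (λ _ sℓ → index sℓ , ∈-allFin _ , lookup≢0 (lookup-index sℓ) (S-positive sℓ) , lookup-index sℓ))
      (sym card≡count)

    zero-count : count zero? (allFin n) ≡ zeros
    zero-count = begin
      count zero? (allFin n)                               ≡⟨ m+n∸n≡m _ (card n S) ⟨
      count zero? (allFin n) + card n S ∸ card n S         ≡⟨ cong (λ c → count zero? (allFin n) + c ∸ card n S) nonzero-count ⟨
      count zero? (allFin n) + count (∁? zero?) (allFin n) ∸ card n S
                                                           ≡⟨ cong (_∸ card n S) (trans (count-complement zero? (allFin n)) (length-tabulate (λ k → k))) ⟩
      zeros                                                ∎
      where open ≡-Reasoning

    left-count : ∀ i → count (left? i) (allFin n) ≡ toℕ i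
    left-count i = count-tabulate-< (left? i) (λ k → k) (<⇒≤ (toℕ<n i)) (λ _ k<i → k<i) (λ _ k<i → k<i)

    nonzero-left-count : ∀ {i} → lookup r i ≢ 0 → count (left? i ∩? ∁? zero?) (allFin n) ≡ before (lookup r i)
    nonzero-left-count {i} ri≢0 =
      count-bijection _≟_ (left? i ∩? ∁? zero?) (λ m → S? m ×-dec (m ≺? lookup r i)) (lookup r) (allFin⁺ n) letters-unique
        (λ _ (k<i , rk≢0) → lookup-∈-letters rk≢0 , lookup-S rk≢0 , from (≺⇔< refl refl (n≢0⇒n>0 rk≢0) 0<ri) k<i)
        (λ (_ , rk≢0) _ rk≡rk′ → lookup-injective rk≡rk′ rk≢0)
        (λ _ (sm , m≺ri) → index sm , ∈-allFin _ ,
          (to (≺⇔< (lookup-index sm) refl (S-positive sm) 0<ri) m≺ri , lookup≢0 (lookup-index sm) (S-positive sm)) ,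
          lookup-index sm)
      where
      0<ri : 0 < lookup r i
      0<ri = n≢0⇒n>0 ri≢0

    position+zerosAfter : ∀ {i} → lookup r i ≢ 0 → toℕ i + zerosAfter r i ≡ before (lookup r i) + zeros
    position+zerosAfter {i} ri≢0 = begin
      toℕ i + zerosAfter r i                   ≡⟨ cong (_+ zerosAfter r i) left-split ⟩
      zerosLeft + before ℓ + zerosAfter r i    ≡⟨ cong (_+ zerosAfter r i) (+-comm zerosLeft (before ℓ)) ⟩
      before ℓ + zerosLeft + zerosAfter r i    ≡⟨ +-assoc (before ℓ) zerosLeft (zerosAfter r i) ⟩
      before ℓ + (zerosLeft + zerosAfter r i)  ≡⟨ cong (before ℓ +_) zeros-split ⟨
      before ℓ + zeros                         ∎
      where
      open ≡-Reasoning
      ℓ : ℕ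
      ℓ = lookup r i
      zerosLeft : ℕ
      zerosLeft = count (left? i ∩? zero?) (allFin n)
      left-split : toℕ i ≡ zerosLeft + before ℓ
      left-split = trans (sym (left-count i))
        (trans (count-split (left? i) zero? (allFin n)) (cong (zerosLeft +_) (nonzero-left-count ri≢0)))
      not-left⇒right : ∀ {k} → lookup r k ≡ 0 → ¬ toℕ k < toℕ i → toℕ i < toℕ k
      not-left⇒right {k} rk≡0 k≮i =
        ≤∧≢⇒< (≮⇒≥ k≮i) (λ i≡k → ri≢0 (trans (cong (lookup r) (toℕ-injective i≡k)) rk≡0))
      zeros-split : zeros ≡ zerosLeft + zerosAfter r i
      zeros-split = begin
        zeros                                                                   ≡⟨ zero-count ⟨
        count zero? (allFin n)                                                  ≡⟨ count-split zero? (left? i) (allFin n) ⟩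
        count (zero? ∩? left? i) (allFin n) + count (zero? ∩? ∁? (left? i)) (allFin n)
          ≡⟨ cong₂ _+_ (count-≐ (zero? ∩? left? i) (left? i ∩? zero?) (swap , swap) (allFin n))
                       (count-≐ (zero? ∩? ∁? (left? i)) (right? i ∩? zero?)
                          ((λ (rk≡0 , k≮i) → not-left⇒right rk≡0 k≮i , rk≡0) , (λ (i<k , rk≡0) → rk≡0 , <⇒≯ i<k))
                          (allFin n)) ⟩
        zerosLeft + zerosAfter r i                                              ∎

    zerosAfter≤zeros : ∀ {i : Fin n} → zerosAfter r i ≤ zeros
    zerosAfter≤zeros {i} = ≤-trans (count-mono (right? i ∩? zero?) zero? proj₂ (allFin n)) (≤-reflexive zero-count)

    zerosAfter-antitone : ∀ {i j : Fin n} → toℕ i < toℕ j → zerosAfter r j ≤ zerosAfter r i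
    zerosAfter-antitone {i} {j} i<j =
      count-mono (right? j ∩? zero?) (right? i ∩? zero?) (λ (j<k , rk≡0) → <-trans i<j j<k , rk≡0) (allFin n)

  rookTriple⇒conditions : ∀ {Z} r → IsRook n r → IsRookTriple r S I Z → Cond1 n S I × Cond2 n S Z × Cond3 S I Z
  rookTriple⇒conditions {Z} r rook (supp , inv , Z-spec) =
    ≺-transitive⇒Cond1 I⊆Δ×S×S ≺-transitive , Z≤zeros , antitone⇒Cond3 Z-antitone
    where
    open RookFacts {r} rook supp inv
    zerosAfter-index : ∀ {ℓ} (s : T (S ℓ)) → zerosAfter r (index s) ≡ Z ℓ
    zerosAfter-index s = Z-spec _ s (index s) (lookup-index s)
    Z≤zeros : Cond2 n S Z
    Z≤zeros ℓ s = subst (_≤ zeros) (zerosAfter-index s) zerosAfter≤zeros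
    Z-antitone : Antitone Z
    Z-antitone sm sℓ m≺ℓ =
      subst₂ _≤_ (zerosAfter-index sℓ) (zerosAfter-index sm) (zerosAfter-antitone (to (index-≺⇔< sm sℓ) m≺ℓ))

  placed-at : ∀ {Z} r → IsRook n r → IsRookTriple r S I Z → ∀ {i ℓ} → lookup r i ≡ ℓ → T (S ℓ) →
    toℕ i + Z ℓ ≡ before ℓ + zeros
  placed-at r rook (supp , inv , Z-spec) {i} refl s =
    trans (cong (toℕ i +_) (sym (Z-spec _ s i refl))) (position+zerosAfter (lookup≢0 refl (S-positive s)))
    where open RookFacts {r} rook supp inv

  letters-agree : ∀ {Z} r r′ → IsRook n r → IsRookTriple r S I Z → IsRook n r′ → IsRookTriple r′ S I Z →
    ∀ i → lookup r i ≢ 0 → lookup r′ i ≡ lookup r i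
  letters-agree {Z} r r′ rook triple rook′ triple′ i ri≢0 = subst (λ j → lookup r′ j ≡ ℓ) j≡i (lookup-index s)
    where
    open RookFacts {r′} rook′ (proj₁ triple′) (proj₁ (proj₂ triple′))
    ℓ : ℕ
    ℓ = lookup r i
    s : T (S ℓ)
    s = from (proj₁ triple ℓ) (n≢0⇒n>0 ri≢0 , i , refl)
    j≡i : index s ≡ i
    j≡i = toℕ-injective (+-cancelʳ-≡ (Z ℓ) _ _
            (trans (placed-at r′ rook′ triple′ (lookup-index s) s) (sym (placed-at r rook triple refl s))))

  rookTriple-unique : ∀ {Z} r r′ → IsRook n r → IsRookTriple r S I Z → IsRook n r′ → IsRookTriple r′ S I Z → r ≡ r′
  rookTriple-unique r r′ rook triple rook′ triple′ =
    trans (sym (tabulate∘lookup r)) (trans (tabulate-cong lookup-agree) (tabulate∘lookup r′))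
    where
    lookup-agree : ∀ i → lookup r i ≡ lookup r′ i
    lookup-agree i with lookup r i ≟ 0 | lookup r′ i ≟ 0
    ... | no ri≢0  | _          = sym (letters-agree r r′ rook triple rook′ triple′ i ri≢0)
    ... | yes ri≡0 | no r′i≢0  = contradiction (trans (sym (letters-agree r′ r rook′ triple′ rook triple i r′i≢0)) ri≡0) r′i≢0
    ... | yes ri≡0 | yes r′i≡0 = trans ri≡0 (sym r′i≡0)

  module Construction (hS : ∀ ℓ → T (S ℓ) → (1 ≤ ℓ) × (ℓ ≤ n))
                      (I⊆Δ×S×S : ∀ b a → T (I b a) → InΔ n b a × T (S b) × T (S a))
                      (≺-trans : ≺-Transitive)
                      {Z : ℕ → ℕ} (Z-antitone : Antitone Z) (Z≤zeros : Cond2 n S Z) where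

    S⊆letters : ∀ {ℓ} → T (S ℓ) → ℓ ∈ letters
    S⊆letters s = ∈-letters (proj₁ (hS _ s)) (proj₂ (hS _ s))

    pos : ℕ → ℕ
    pos ℓ = before ℓ + (zeros ∸ Z ℓ)

    before-< : ∀ {m ℓ} → T (S m) → T (S ℓ) → m ≺ ℓ → before m < before ℓ
    before-< sm sℓ m≺ℓ = count-mono-< (λ k → S? k ×-dec (k ≺? _)) (λ k → S? k ×-dec (k ≺? _))
      (λ (sk , k≺m) → sk , ≺-trans sk sm sℓ k≺m m≺ℓ) (S⊆letters sm) (sm , m≺ℓ) (≺-irrefl ∘ proj₂)

    pos-< : ∀ {m ℓ} → T (S m) → T (S ℓ) → m ≺ ℓ → pos m < pos ℓ
    pos-< sm sℓ m≺ℓ = +-mono-<-≤ (before-< sm sℓ m≺ℓ) (∸-monoʳ-≤ zeros (Z-antitone sm sℓ m≺ℓ))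

    pos-injective : ∀ {m ℓ} → T (S m) → T (S ℓ) → pos m ≡ pos ℓ → m ≡ ℓ
    pos-injective {m} {ℓ} sm sℓ pm≡pℓ with m ≟ ℓ
    ... | yes m≡ℓ = m≡ℓ
    ... | no m≢ℓ with ≺-connex m≢ℓ
    ...   | inj₁ m≺ℓ = contradiction pm≡pℓ (<⇒≢ (pos-< sm sℓ m≺ℓ))
    ...   | inj₂ ℓ≺m = contradiction (sym pm≡pℓ) (<⇒≢ (pos-< sℓ sm ℓ≺m))

    pos<n : ∀ {ℓ} → T (S ℓ) → pos ℓ < n
    pos<n {ℓ} sℓ = begin-strict
      before ℓ + (zeros ∸ Z ℓ)  <⟨ +-mono-<-≤ before<card (m∸n≤m zeros (Z ℓ)) ⟩
      card n S + zeros          ≡⟨ m+[n∸m]≡n card≤n ⟩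
      n                         ∎
      where
      open ≤-Reasoning
      before<card : before ℓ < card n S
      before<card = subst (before ℓ <_) (sym card≡count)
        (count-mono-< (λ k → S? k ×-dec (k ≺? ℓ)) S? proj₁ (S⊆letters sℓ) sℓ (≺-irrefl ∘ proj₂))

    pos+Z : ∀ {ℓ} → T (S ℓ) → pos ℓ + Z ℓ ≡ before ℓ + zeros
    pos+Z {ℓ} s = trans (+-assoc (before ℓ) _ _) (cong (before ℓ +_) (m∸n+n≡m (Z≤zeros ℓ s)))

    letterAt : ℕ → ℕ
    letterAt p with any? (λ ℓ → S? ℓ ×-dec (pos ℓ ≟ p)) letters
    ... | yes found = proj₁ (satisfied found)
    ... | no _      = 0

    letterAt-spec : ∀ p → letterAt p ≡ 0 ⊎ (T (S (letterAt p)) × pos (letterAt p) ≡ p)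
    letterAt-spec p with any? (λ ℓ → S? ℓ ×-dec (pos ℓ ≟ p)) letters
    ... | yes found = inj₂ (proj₂ (satisfied found))
    ... | no _      = inj₁ refl

    letterAt-pos : ∀ {ℓ} → T (S ℓ) → letterAt (pos ℓ) ≡ ℓ
    letterAt-pos {ℓ} sℓ with any? (λ m → S? m ×-dec (pos m ≟ pos ℓ)) letters
    ... | yes found = pos-injective (proj₁ (proj₂ (satisfied found))) sℓ (proj₂ (proj₂ (satisfied found)))
    ... | no none   = contradiction (lose (S⊆letters sℓ) (sℓ , refl)) none

    r : Vec ℕ n
    r = tabulate (letterAt ∘ toℕ)

    slot : ∀ {ℓ} → T (S ℓ) → Fin n
    slot s = fromℕ< (pos<n s)

    lookup-slot : ∀ {ℓ} (s : T (S ℓ)) → lookup r (slot s) ≡ ℓ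
    lookup-slot s = trans (lookup∘tabulate _ (slot s)) (trans (cong letterAt (toℕ-fromℕ< (pos<n s))) (letterAt-pos s))

    toℕ-slot : ∀ {ℓ} (s : T (S ℓ)) → toℕ (slot s) ≡ pos ℓ
    toℕ-slot s = toℕ-fromℕ< (pos<n s)

    lookup-spec : ∀ i → lookup r i ≡ 0 ⊎ (T (S (lookup r i)) × pos (lookup r i) ≡ toℕ i)
    lookup-spec i rewrite lookup∘tabulate (letterAt ∘ toℕ) i = letterAt-spec (toℕ i)

    lookup-positive : ∀ {i ℓ} → lookup r i ≡ ℓ → 0 < ℓ → T (S ℓ) × pos ℓ ≡ toℕ i
    lookup-positive {i} refl 0<ri with lookup-spec i
    ... | inj₁ ri≡0  = contradiction ri≡0 (>⇒≢ 0<ri)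
    ... | inj₂ s-pos = s-pos

    rook : IsRook n r
    rook = bounded , distinct
      where
      bounded : ∀ i → lookup r i ≤ n
      bounded i with lookup-spec i
      ... | inj₁ ri≡0 = subst (_≤ n) (sym ri≡0) z≤n
      ... | inj₂ (s , _) = proj₂ (hS _ s)
      distinct : ∀ i j → i ≢ j → lookup r i ≡ lookup r j → lookup r i ≡ 0
      distinct i j i≢j ri≡rj with lookup-spec i | lookup-spec j
      ... | inj₁ ri≡0 | _ = ri≡0
      ... | inj₂ _ | inj₁ rj≡0 = trans ri≡rj rj≡0
      ... | inj₂ (_ , pri≡i) | inj₂ (_ , prj≡j) =
        contradiction (toℕ-injective (trans (sym pri≡i) (trans (cong pos ri≡rj) prj≡j))) i≢j

    supp : ∀ ℓ → T (S ℓ) ⇔ InSupp r ℓ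
    supp ℓ = mk⇔ (λ s → proj₁ (hS ℓ s) , slot s , lookup-slot s)
                 (λ (0<ℓ , i , ri≡ℓ) → proj₁ (lookup-positive ri≡ℓ 0<ℓ))

    inv : ∀ b a → T (I b a) ⇔ InInv r b a
    inv b a = mk⇔ to-inversion from-inversion
      where
      to-inversion : T (I b a) → InInv r b a
      to-inversion Iba =
        let ((_ , a<b , 0<a) , sb , sa) = I⊆Δ×S×S b a Iba in
        slot sb , slot sa ,
        subst₂ _<_ (sym (toℕ-slot sb)) (sym (toℕ-slot sa)) (pos-< sb sa (inj₁ (a<b , Iba))) ,
        lookup-slot sb , lookup-slot sa , a<b , 0<a
      from-inversion : InInv r b a → T (I b a)
      from-inversion (i , j , i<j , ri≡b , rj≡a , a<b , 0<a) =
        let (sb , pb≡i) = lookup-positive ri≡b (<-trans 0<a a<b)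
            (sa , pa≡j) = lookup-positive rj≡a 0<a
        in decidable-stable (T? (I b a)) λ ¬Iba →
             <-asym i<j (subst₂ _<_ pa≡j pb≡i (pos-< sa sb (inj₂ (a<b , ¬Iba))))

    Z-spec : ∀ ℓ → T (S ℓ) → ZrIs r ℓ (Z ℓ)
    Z-spec ℓ s i refl = +-cancelˡ-≡ (toℕ i) _ _ (begin
      toℕ i + zerosAfter r i  ≡⟨ position+zerosAfter (lookup≢0 refl (S-positive s)) ⟩
      before ℓ + zeros        ≡⟨ pos+Z s ⟨
      pos ℓ + Z ℓ             ≡⟨ cong (_+ Z ℓ) (proj₂ (lookup-positive refl (S-positive s))) ⟩
      toℕ i + Z ℓ             ∎)
      where
      open ≡-Reasoning
      open RookFacts {r} rook supp inv

    rookTriple : Σ (Vec ℕ n) λ r → IsRook n r × IsRookTriple r S I Z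
    rookTriple = r , rook , supp , inv , Z-spec

  conditions⇒rookTriple : (∀ ℓ → T (S ℓ) → (1 ≤ ℓ) × (ℓ ≤ n)) → ∀ {Z} →
    Cond1 n S I × Cond2 n S Z × Cond3 S I Z → Σ (Vec ℕ n) λ r → IsRook n r × IsRookTriple r S I Z
  conditions⇒rookTriple hS (C1 , C2 , C3) =
    Construction.rookTriple hS (proj₁ C1) (Cond1⇒≺-transitive hS C1) (Cond3⇒antitone C3) C2

proposition4p8 : (n : ℕ) (S : ℕ → Bool) (I : ℕ → ℕ → Bool) (Z : ℕ → ℕ) →
    (∀ ℓ → T (S ℓ) → (1 ≤ ℓ) × (ℓ ≤ n)) →
    (∀ b a → T (I b a) → InΔ n b a) →
    ((Σ (Vec ℕ n) λ r → IsRook n r × IsRookTriple r S I Z)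
       ⇔ (Cond1 n S I × Cond2 n S Z × Cond3 S I Z))
    × (Cond1 n S I × Cond2 n S Z × Cond3 S I Z →
       ∀ (r r′ : Vec ℕ n) → IsRook n r → IsRookTriple r S I Z →
         IsRook n r′ → IsRookTriple r′ S I Z → r ≡ r′)
proposition4p8 n S I Z hS _ =
  mk⇔ (λ (r , rook , triple) → rookTriple⇒conditions r rook triple) (conditions⇒rookTriple hS) ,
  λ _ → rookTriple-unique
  where open RookTriples n S I
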